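{- Let $(\boldsymbol\sigma,\mathbf G)$ be drawn from the equitable stochastic block model $\mathcal G^{\,\mathrm{eq}}_{n,d,k,\eta}$ (with $d,k,\eta$ fixed), and let $\mathbf P$ be the partition matrix of the planted labelling $\boldsymbol\sigma$. For every $s\ge1$ and every increasing nonnegative function $\Delta(n)$, $\Pr\left[\left|\langle\mathbf P,q_s(A_{\mathbf G})\rangle-q_s(d\eta)n\right|>\Delta(n)\right]=O\!\left(\frac n{\Delta(n)^2}\right)$.
   Context: Equitable SBM: $M=\eta I_k+\frac{1-\eta}kJ_k$, defined when $k|n$, $dM$ is a nonnegative integer matrix and $dM_{ii}n/k$ even; choose a uniformly random balanced $\boldsymbol\sigma:[n]\to[k]$, place a uniformly random $dM_{ii}$-regular graph on each class $\boldsymbol\sigma^{ -1}(i)$ and a uniformly random bipartite graph with all degrees $dM_{ij}$ between $\boldsymbol\sigma^{ -1}(i),\boldsymbol\sigma^{ -1}(j)$, $i<j$. The partition matrix of $\sigma$ has $(u,v)$ entry $1$ if $\sigma(u)=\sigma(v)$ and $-1/(k-1)$ otherwise. $q_0=1$, $q_1(z)=z$, $q_2(z)=z^2-d$, $q_{s+1}=zq_s-(d-1)q_{s-1}$ for $s\ge2$; $q_s(A_G)$ is the matrix counting length-$s$ non-backtracking walks in the $d$-regular graph $G$. Asymptotics as $n\to\infty$.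
   Formalization: The parameter η is rational, and the increasing nonnegative function $\Delta(n)$ takes values in ℚ. -}

module Defs where

open import Data.Bool using (Bool; true; false; if_then_else_; _∧_; not)
open import Data.Nat as ℕ using (ℕ; zero; suc)
open import Data.Fin as Fin using (Fin)
open import Data.List using (List; []; _∷_; [_]; map; concatMap; allFin; length; filterᵇ; cartesianProduct)
open import Data.Product using (_×_; _,_)
open import Data.Integer using (+_; -[1+_])
open import Data.Rational using (ℚ; _/_; 0ℚ; 1ℚ; _+_; _-_; _*_; ∣_∣; _≤ᵇ_)
open import Data.Rational.Properties using (_≟_)
import Data.Vec.Functional as VF
open import Relation.Nullary using (does)

ℕ→ℚ : ℕ → ℚ
ℕ→ℚ m = + m / 1

sumFin : (n : ℕ) → (Fin n → ℚ) → ℚ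
sumFin zero    f = 0ℚ
sumFin (suc n) f = f Fin.zero + sumFin n (λ i → f (Fin.suc i))

countFin : (n : ℕ) → (Fin n → Bool) → ℕ
countFin zero    p = 0
countFin (suc n) p = (if p Fin.zero then 1 else 0) ℕ.+ countFin n (λ i → p (Fin.suc i))

allFinᵇ : (n : ℕ) → (Fin n → Bool) → Bool
allFinᵇ zero    p = true
allFinᵇ (suc n) p = p Fin.zero ∧ allFinᵇ n (λ i → p (Fin.suc i))

_==F_ : ∀ {n} → Fin n → Fin n → Bool
i ==F j = does (i Fin.≟ j)

_==ℚ_ : ℚ → ℚ → Bool
p ==ℚ q = does (p ≟ q)

-- 1/m for m ≥ 1 (value 0 at m = 0, never used)
inv : ℕ → ℚ
inv zero    = 0ℚ
inv (suc m) = + 1 / suc m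

-- -1/m for m ≥ 1 (value 0 at m = 0, never used since k ≥ 2)
negInv : ℕ → ℚ
negInv zero    = 0ℚ
negInv (suc m) = -[1+ 0 ] / suc m

Matrix : ℕ → Set
Matrix n = Fin n → Fin n → ℚ

idM : ∀ {n} → Matrix n
idM i j = if i ==F j then 1ℚ else 0ℚ

_⊗_ : ∀ {n} → Matrix n → Matrix n → Matrix n
_⊗_ {n} A B i j = sumFin n (λ l → A i l * B l j)

subM : ∀ {n} → Matrix n → Matrix n → Matrix n
subM A B i j = A i j - B i j

scaleM : ∀ {n} → ℚ → Matrix n → Matrix n
scaleM c A i j = c * A i j

⟨_,_⟩ : ∀ {n} → Matrix n → Matrix n → ℚ
⟨_,_⟩ {n} P Q = sumFin n (λ u → sumFin n (λ v → P u v * Q u v))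

-- The non-backtracking polynomials q_s, evaluated in any "algebra" X given
-- by: the unit, left multiplication by z, subtraction and scalar multiplication.
-- q_0 = 1, q_1 = z, q_2 = z² - d, q_{s+1} = z q_s - (d-1) q_{s-1} (s ≥ 2).

qGen : {X : Set} → (d : ℕ) → (one : X) → (mulZ : X → X)
     → (sub : X → X → X) → (scale : ℚ → X → X) → ℕ → X
qGen d one mulZ sub scale zero = one
qGen d one mulZ sub scale (suc zero) = mulZ one
qGen d one mulZ sub scale (suc (suc zero)) = sub (mulZ (mulZ one)) (scale (ℕ→ℚ d) one)
qGen d one mulZ sub scale (suc (suc (suc s))) =
  sub (mulZ (qGen d one mulZ sub scale (suc (suc s))))
      (scale (ℕ→ℚ d - 1ℚ) (qGen d one mulZ sub scale (suc s)))

qPoly : (d s : ℕ) → ℚ → ℚ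
qPoly d s z = qGen d 1ℚ (λ x → z * x) _-_ _*_ s

qMat : (d s : ℕ) → ∀ {n} → Matrix n → Matrix n
qMat d s A = qGen d idM (λ B → A ⊗ B) subM scaleM s

Graph : ℕ → Set
Graph n = Fin n → Fin n → Bool

adj : ∀ {n} → Graph n → Matrix n
adj G u v = if G u v then 1ℚ else 0ℚ

isSimple : ∀ {n} → Graph n → Bool
isSimple {n} G =
  allFinᵇ n (λ u → not (G u u) ∧ allFinᵇ n (λ v → does (Data.Bool._≟_ (G u v) (G v u))))
  where import Data.Bool

Labelling : ℕ → ℕ → Set
Labelling n k = Fin n → Fin k

isBalanced : ∀ {n k} → Labelling n k → Bool
isBalanced {n} {k} σ =
  allFinᵇ k (λ i → does (countFin n (λ v → σ v ==F i) ℕ.* k ℕ.≟ n))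

dM : (d k : ℕ) → ℚ → Fin k → Fin k → ℚ
dM d k η i j = ℕ→ℚ d * ((if i ==F j then η else 0ℚ) + (1ℚ - η) * inv k)

-- G is in the support of the model given σ: G is simple and every vertex u
-- has exactly dM_{σ(u) j} neighbours in class j, for every class j
-- (i.e. G[σ⁻¹(i)] is dM_ii-regular and G[σ⁻¹(i),σ⁻¹(j)] is dM_ij-biregular).
isCompatible : (d k : ℕ) → ℚ → ∀ {n} → Labelling n k → Graph n → Bool
isCompatible d k η {n} σ G =
  isSimple G ∧
  allFinᵇ n (λ u → allFinᵇ k (λ j →
    ℕ→ℚ (countFin n (λ v → (σ v ==F j) ∧ G u v)) ==ℚ dM d k η (σ u) j))

partitionMatrix : ∀ {n k} → Labelling n k → Matrix n
partitionMatrix {n} {k} σ u v = if σ u ==F σ v then 1ℚ else negInv (k ℕ.∸ 1)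

allFuns : {A : Set} → List A → (n : ℕ) → List (Fin n → A)
allFuns xs zero    = [ (λ ()) ]
allFuns xs (suc n) = concatMap (λ x → map (λ f → x VF.∷ f) (allFuns xs n)) xs

allLabellings : (n k : ℕ) → List (Labelling n k)
allLabellings n k = allFuns (allFin k) n

allGraphs : (n : ℕ) → List (Graph n)
allGraphs n = allFuns (allFuns (true ∷ false ∷ []) n) n

-- support of G^eq_{n,d,k,η}: pairs (σ, G) with σ balanced and G compatible.
-- The model's law is the uniform distribution on this finite set (the number of
-- compatible G is the same for every balanced σ, since all classes have size n/k).
support : (d k : ℕ) → ℚ → (n : ℕ) → List (Labelling n k × Graph n)
support d k η n =
  filterᵇ (λ { (σ , G) → isBalanced σ ∧ isCompatible d k η σ G })
          (cartesianProduct (allLabellings n k) (allGraphs n))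

deviation : (d k : ℕ) → ℚ → (s n : ℕ) → Labelling n k → Graph n → ℚ
deviation d k η s n σ G =
  ⟨ partitionMatrix σ , qMat d s (adj G) ⟩ - qPoly d s (ℕ→ℚ d * η) * ℕ→ℚ n

badCount : (d k : ℕ) → ℚ → (s n : ℕ) → ℚ → ℕ
badCount d k η s n t =
  length (filterᵇ (λ { (σ , G) → not (∣ deviation d k η s n σ G ∣ ≤ᵇ t) }) (support d k η n))

totalCount : (d k : ℕ) → ℚ → (n : ℕ) → ℕ
totalCount d k η n = length (support d k η n)

{-# OPTIONS --safe #-}

-- On the support of the equitable model the statistic is deterministic, so the bound holds
-- with C = 0.
-- Compatibility of G with σ says that σ is an equitable partition of A_G with quotient matrix
-- dM = dη I + d(1-η)/k J, i.e. A_G S = S dM for the class-indicator matrix S. Hence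
-- q_s(A_G) S = S q_s(dM), and q_s(dM) = q_s(dη) I + y J because the matrices z I + y J form an
-- algebra. Row u of P is (1-ν) S_{σ(u)} + ν 1 with ν = -1/(k-1); pairing it with row u of
-- q_s(A_G) gives (1-ν)(z + y) + ν(z + k y) = z + (1 + (k-1)ν) y = z, where z = q_s(dη).
-- Summing over the rows, ⟨P, q_s(A_G)⟩ = n q_s(dη) exactly.

module Submission where

open import Defs
open import Data.Nat using (ℕ)
open import Data.Nat.Divisibility using (_∣_)
open import Data.Fin using (Fin)
open import Data.Product using (∃; _×_)
open import Data.Rational using (ℚ; _≤_; _*_; 0ℚ)
open import Relation.Binary.PropositionalEquality using (_≡_)

open import Algebra.Bundles using (CommutativeRing)
open import Data.Bool using (Bool; true; false; if_then_else_; _∧_; not; T)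
open import Data.Bool.Properties using (T-∧; T-not-≡)
open import Data.Fin using (zero; suc)
import Data.Integer as ℤ
import Data.Integer.Properties as ℤ
open import Data.List using (length; cartesianProduct)
open import Data.List.Properties using (filter-none)
import Data.List.Relation.Unary.All as All
open import Data.List.Relation.Unary.All.Properties using (all-filter)
open import Data.Nat as ℕ using (s≤s; z≤n)
open import Data.Nat.Coprimality as Coprime using (1-coprimeTo)
open import Data.Product using (_,_; proj₁; proj₂; ∃-syntax)
open import Data.Rational as ℚ using (mkℚ; _+_; _-_; -_; 1ℚ; 1/_; ∣_∣; _≤ᵇ_)
import Data.Rational.Properties as ℚ
open import Data.Rational.Solver using (module +-*-Solver)
open import Function using (_∘_; Equivalence)
open import Relation.Binary.PropositionalEquality
  using (refl; sym; trans; cong; cong₂; subst; module ≡-Reasoning)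
open import Relation.Nullary using (¬_; yes)
open import Relation.Nullary.Decidable using (T?)

open +-*-Solver
open import Algebra.Properties.Semiring.Sum (CommutativeRing.semiring ℚ.+-*-commutativeRing)
  using (sum; sum-syntax; sum-cong-≗; ∑-distrib-+; ∑-comm; *-distribˡ-sum; *-distribʳ-sum)
open import Algebra.Properties.Ring (CommutativeRing.ring ℚ.+-*-commutativeRing) using (-1*x≈-x)

ℕ→ℚ≡mkℚ : ∀ m → ℕ→ℚ m ≡ mkℚ (ℤ.+ m) 0 (Coprime.sym (1-coprimeTo m))
ℕ→ℚ≡mkℚ m = ℚ.normalize-coprime (Coprime.sym (1-coprimeTo m))

ℕ→ℚ-suc : ∀ m → ℕ→ℚ (ℕ.suc m) ≡ 1ℚ + ℕ→ℚ m
ℕ→ℚ-suc m rewrite ℕ→ℚ≡mkℚ m =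
  cong (λ z → z ℚ./ 1) (sym (cong (ℤ._+_ (ℤ.+ 1)) (ℤ.*-identityʳ (ℤ.+ m))))

ℕ→ℚ*negInv : ∀ m → ℕ→ℚ (ℕ.suc m) * negInv (ℕ.suc m) ≡ - 1ℚ
ℕ→ℚ*negInv m rewrite ℕ→ℚ≡mkℚ (ℕ.suc m) | ℚ.normalize-coprime {1} {m} (1-coprimeTo (ℕ.suc m)) =
  trans (sym (ℚ.neg-distribʳ-* p (1/ p))) (cong -_ (ℚ.*-inverseʳ p))
  where p = mkℚ (ℤ.+ ℕ.suc m) 0 (Coprime.sym (1-coprimeTo (ℕ.suc m)))

sumFin≡sum : ∀ n (f : Fin n → ℚ) → sumFin n f ≡ sum f
sumFin≡sum ℕ.zero    f = refl
sumFin≡sum (ℕ.suc n) f = cong (f zero +_) (sumFin≡sum n (f ∘ suc))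

∑-distrib-- : ∀ {n} (f g : Fin n → ℚ) → ∑[ i < n ] (f i - g i) ≡ ∑[ i < n ] f i - ∑[ i < n ] g i
∑-distrib-- {n} f g = begin
  ∑[ i < n ] (f i - g i)                    ≡⟨ ∑-distrib-+ f (λ i → - g i) ⟩
  ∑[ i < n ] f i + ∑[ i < n ] (- g i)       ≡⟨ cong (∑[ i < n ] f i +_) (sum-cong-≗ λ i → sym (-1*x≈-x (g i))) ⟩
  ∑[ i < n ] f i + ∑[ i < n ] (- 1ℚ * g i)  ≡⟨ cong (∑[ i < n ] f i +_) (sym (*-distribˡ-sum (- 1ℚ) g)) ⟩
  ∑[ i < n ] f i + - 1ℚ * ∑[ i < n ] g i    ≡⟨ cong (∑[ i < n ] f i +_) (-1*x≈-x _) ⟩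
  ∑[ i < n ] f i - ∑[ i < n ] g i           ∎
  where open ≡-Reasoning

∑-const : ∀ n c → ∑[ i < n ] c ≡ ℕ→ℚ n * c
∑-const ℕ.zero    c = sym (ℚ.*-zeroˡ c)
∑-const (ℕ.suc n) c = begin
  c + ∑[ i < n ] c     ≡⟨ cong (c +_) (∑-const n c) ⟩
  c + ℕ→ℚ n * c        ≡⟨ solve 2 (λ c m → c :+ m :* c := (con 1ℚ :+ m) :* c) refl c (ℕ→ℚ n) ⟩
  (1ℚ + ℕ→ℚ n) * c     ≡⟨ cong (_* c) (sym (ℕ→ℚ-suc n)) ⟩
  ℕ→ℚ (ℕ.suc n) * c    ∎
  where open ≡-Reasoning

idM-sym : ∀ {n} (i j : Fin n) → idM i j ≡ idM j i
idM-sym zero    zero    = refl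
idM-sym zero    (suc j) = refl
idM-sym (suc i) zero    = refl
idM-sym (suc i) (suc j) = idM-sym i j

∑-idM : ∀ {n} (i : Fin n) (f : Fin n → ℚ) → ∑[ j < n ] (idM i j * f j) ≡ f i
∑-idM {ℕ.suc n} zero f = begin
  1ℚ * f zero + ∑[ j < n ] (0ℚ * f (suc j)) ≡⟨ cong (1ℚ * f zero +_) (sum-cong-≗ (ℚ.*-zeroˡ ∘ f ∘ suc)) ⟩
  1ℚ * f zero + ∑[ j < n ] 0ℚ              ≡⟨ cong (1ℚ * f zero +_) (trans (∑-const n 0ℚ) (ℚ.*-zeroʳ (ℕ→ℚ n))) ⟩
  1ℚ * f zero + 0ℚ                         ≡⟨ solve 1 (λ x → con 1ℚ :* x :+ con 0ℚ := x) refl (f zero) ⟩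
  f zero                                   ∎
  where open ≡-Reasoning
∑-idM {ℕ.suc n} (suc i) f = begin
  0ℚ * f zero + ∑[ j < n ] (idM i j * f (suc j))  ≡⟨ cong (0ℚ * f zero +_) (∑-idM i (f ∘ suc)) ⟩
  0ℚ * f zero + f (suc i)                         ≡⟨ solve 2 (λ x y → con 0ℚ :* x :+ y := y) refl (f zero) (f (suc i)) ⟩
  f (suc i)                                       ∎
  where open ≡-Reasoning

∑-idM-row : ∀ {n} (i : Fin n) → ∑[ j < n ] idM i j ≡ 1ℚ
∑-idM-row i = trans (sum-cong-≗ λ j → sym (ℚ.*-identityʳ (idM i j))) (∑-idM i (λ _ → 1ℚ))

∑-indicator : ∀ {n} (p : Fin n → Bool) → ∑[ i < n ] (if p i then 1ℚ else 0ℚ) ≡ ℕ→ℚ (countFin n p)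
∑-indicator {ℕ.zero}  p = refl
∑-indicator {ℕ.suc n} p with p zero
... | true  = trans (cong (1ℚ +_) (∑-indicator (p ∘ suc))) (sym (ℕ→ℚ-suc (countFin n (p ∘ suc))))
... | false = trans (ℚ.+-identityˡ (sum (λ i → if p (suc i) then 1ℚ else 0ℚ))) (∑-indicator (p ∘ suc))

indicator-* : ∀ x y → (if x then 1ℚ else 0ℚ) * (if y then 1ℚ else 0ℚ) ≡ (if y ∧ x then 1ℚ else 0ℚ)
indicator-* true  true  = refl
indicator-* true  false = refl
indicator-* false true  = refl
indicator-* false false = refl

qGen-preserves : {X Y : Set} (_∼_ : X → Y → Set) (d : ℕ)
  {one₁ : X} {mulZ₁ : X → X} {sub₁ : X → X → X} {scale₁ : ℚ → X → X}
  {one₂ : Y} {mulZ₂ : Y → Y} {sub₂ : Y → Y → Y} {scale₂ : ℚ → Y → Y} →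
  one₁ ∼ one₂ →
  (∀ {x y} → x ∼ y → mulZ₁ x ∼ mulZ₂ y) →
  (∀ {x y x′ y′} → x ∼ y → x′ ∼ y′ → sub₁ x x′ ∼ sub₂ y y′) →
  (∀ {x y} c → x ∼ y → scale₁ c x ∼ scale₂ c y) →
  ∀ s → qGen d one₁ mulZ₁ sub₁ scale₁ s ∼ qGen d one₂ mulZ₂ sub₂ scale₂ s
qGen-preserves _∼_ d {one₁} {mulZ₁} {sub₁} {scale₁} {one₂} {mulZ₂} {sub₂} {scale₂} one mulZ sub scale = go
  where
  go : ∀ s → qGen d one₁ mulZ₁ sub₁ scale₁ s ∼ qGen d one₂ mulZ₂ sub₂ scale₂ s
  go ℕ.zero                      = one
  go (ℕ.suc ℕ.zero)              = mulZ one
  go (ℕ.suc (ℕ.suc ℕ.zero))      = sub (mulZ (mulZ one)) (scale (ℕ→ℚ d) one)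
  go (ℕ.suc (ℕ.suc (ℕ.suc s)))   = sub (mulZ (go (ℕ.suc (ℕ.suc s)))) (scale (ℕ→ℚ d - 1ℚ) (go (ℕ.suc s)))

module _ {n k : ℕ} (σ : Labelling n k) where

  classSum : Matrix n → Fin n → Fin k → ℚ
  classSum X u c = ∑[ v < n ] (X u v * idM (σ v) c)

  -- σ is an equitable partition for X, with quotient matrix z I + y J.
  record Equitable (X : Matrix n) (z y : ℚ) : Set where
    constructor equitable
    field classSum≡ : ∀ u c → classSum X u c ≡ z * idM (σ u) c + y

  open Equitable

  rowSum≡∑classSum : ∀ X u → ∑[ v < n ] X u v ≡ ∑[ c < k ] classSum X u c
  rowSum≡∑classSum X u = begin
    ∑[ v < n ] X u v
      ≡⟨ sum-cong-≗ (λ v → sym (trans (cong (X u v *_) (∑-idM-row (σ v))) (ℚ.*-identityʳ (X u v)))) ⟩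
    ∑[ v < n ] (X u v * ∑[ c < k ] idM (σ v) c)
      ≡⟨ sum-cong-≗ (λ v → *-distribˡ-sum (X u v) (idM (σ v))) ⟩
    ∑[ v < n ] ∑[ c < k ] (X u v * idM (σ v) c)
      ≡⟨ ∑-comm (λ v c → X u v * idM (σ v) c) ⟩
    ∑[ c < k ] classSum X u c ∎
    where open ≡-Reasoning

  classSum-idM : ∀ u c → classSum idM u c ≡ idM (σ u) c
  classSum-idM u c = ∑-idM u (λ v → idM (σ v) c)

  classSum-⊗ : ∀ A X u c → classSum (A ⊗ X) u c ≡ ∑[ l < n ] (A u l * classSum X l c)
  classSum-⊗ A X u c = begin
    ∑[ v < n ] (sumFin n (λ l → A u l * X l v) * idM (σ v) c)
      ≡⟨ sum-cong-≗ (λ v → cong (_* idM (σ v) c) (sumFin≡sum n (λ l → A u l * X l v))) ⟩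
    ∑[ v < n ] (∑[ l < n ] (A u l * X l v) * idM (σ v) c)
      ≡⟨ sum-cong-≗ (λ v → *-distribʳ-sum (idM (σ v) c) (λ l → A u l * X l v)) ⟩
    ∑[ v < n ] ∑[ l < n ] (A u l * X l v * idM (σ v) c)
      ≡⟨ ∑-comm (λ v l → A u l * X l v * idM (σ v) c) ⟩
    ∑[ l < n ] ∑[ v < n ] (A u l * X l v * idM (σ v) c)
      ≡⟨ sum-cong-≗ (λ l → sum-cong-≗ (λ v → ℚ.*-assoc (A u l) (X l v) (idM (σ v) c))) ⟩
    ∑[ l < n ] ∑[ v < n ] (A u l * (X l v * idM (σ v) c))
      ≡⟨ sum-cong-≗ (λ l → sym (*-distribˡ-sum (A u l) (λ v → X l v * idM (σ v) c))) ⟩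
    ∑[ l < n ] (A u l * classSum X l c) ∎
    where open ≡-Reasoning

  classSum-subM : ∀ X Y u c → classSum (subM X Y) u c ≡ classSum X u c - classSum Y u c
  classSum-subM X Y u c = trans
    (sum-cong-≗ λ v → solve 3 (λ x y e → (x :- y) :* e := x :* e :- y :* e) refl (X u v) (Y u v) (idM (σ v) c))
    (∑-distrib-- (λ v → X u v * idM (σ v) c) (λ v → Y u v * idM (σ v) c))

  classSum-scaleM : ∀ a X u c → classSum (scaleM a X) u c ≡ a * classSum X u c
  classSum-scaleM a X u c = trans
    (sum-cong-≗ λ v → ℚ.*-assoc a (X u v) (idM (σ v) c))
    (sym (*-distribˡ-sum a (λ v → X u v * idM (σ v) c)))

  Equitable⇒rowSum : ∀ {X z y} → Equitable X z y → ∀ u → ∑[ v < n ] X u v ≡ z + ℕ→ℚ k * y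
  Equitable⇒rowSum {X} {z} {y} (equitable eq) u = begin
    ∑[ v < n ] X u v
      ≡⟨ rowSum≡∑classSum X u ⟩
    ∑[ c < k ] classSum X u c
      ≡⟨ sum-cong-≗ (eq u) ⟩
    ∑[ c < k ] (z * idM (σ u) c + y)
      ≡⟨ ∑-distrib-+ (λ c → z * idM (σ u) c) (λ _ → y) ⟩
    ∑[ c < k ] (z * idM (σ u) c) + ∑[ c < k ] y
      ≡⟨ cong₂ _+_ (sym (*-distribˡ-sum z (idM (σ u)))) (∑-const k y) ⟩
    z * ∑[ c < k ] idM (σ u) c + ℕ→ℚ k * y
      ≡⟨ cong (λ t → z * t + ℕ→ℚ k * y) (∑-idM-row (σ u)) ⟩
    z * 1ℚ + ℕ→ℚ k * y
      ≡⟨ cong (_+ ℕ→ℚ k * y) (ℚ.*-identityʳ z) ⟩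
    z + ℕ→ℚ k * y ∎
    where open ≡-Reasoning

  equitable-idM : Equitable idM 1ℚ 0ℚ
  equitable-idM = equitable λ u c →
    trans (classSum-idM u c) (solve 1 (λ e → e := con 1ℚ :* e :+ con 0ℚ) refl (idM (σ u) c))

  equitable-subM : ∀ {X z y X′ z′ y′} → Equitable X z y → Equitable X′ z′ y′ →
                   Equitable (subM X X′) (z - z′) (y - y′)
  equitable-subM {X} {z} {y} {X′} {z′} {y′} (equitable eq) (equitable eq′) = equitable λ u c → begin
    classSum (subM X X′) u c
      ≡⟨ classSum-subM X X′ u c ⟩
    classSum X u c - classSum X′ u c
      ≡⟨ cong₂ _-_ (eq u c) (eq′ u c) ⟩
    (z * idM (σ u) c + y) - (z′ * idM (σ u) c + y′)
      ≡⟨ solve 5 (λ z e y z′ y′ → (z :* e :+ y) :- (z′ :* e :+ y′) := (z :- z′) :* e :+ (y :- y′))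
          refl z (idM (σ u) c) y z′ y′ ⟩
    (z - z′) * idM (σ u) c + (y - y′) ∎
    where open ≡-Reasoning

  equitable-scaleM : ∀ {X z y} a → Equitable X z y → Equitable (scaleM a X) (a * z) (a * y)
  equitable-scaleM {X} {z} {y} a (equitable eq) = equitable λ u c → begin
    classSum (scaleM a X) u c  ≡⟨ classSum-scaleM a X u c ⟩
    a * classSum X u c         ≡⟨ cong (a *_) (eq u c) ⟩
    a * (z * idM (σ u) c + y)  ≡⟨ solve 4 (λ a z e y → a :* (z :* e :+ y) := a :* z :* e :+ a :* y) refl a z (idM (σ u) c) y ⟩
    a * z * idM (σ u) c + a * y ∎
    where open ≡-Reasoning

  -- Quotient matrices of the form z I + y J are closed under products:
  -- (a I + b J)(z I + y J) = a z I + (z b + y (a + k b)) J.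
  equitable-⊗ : ∀ {A a b X z y} → Equitable A a b → Equitable X z y →
                Equitable (A ⊗ X) (a * z) (z * b + y * (a + ℕ→ℚ k * b))
  equitable-⊗ {A} {a} {b} {X} {z} {y} eqA (equitable eqX) = equitable λ u c → begin
    classSum (A ⊗ X) u c
      ≡⟨ classSum-⊗ A X u c ⟩
    ∑[ l < n ] (A u l * classSum X l c)
      ≡⟨ sum-cong-≗ (λ l → cong (A u l *_) (eqX l c)) ⟩
    ∑[ l < n ] (A u l * (z * idM (σ l) c + y))
      ≡⟨ sum-cong-≗ (λ l → solve 4 (λ x z e y → x :* (z :* e :+ y) := z :* (x :* e) :+ y :* x)
          refl (A u l) z (idM (σ l) c) y) ⟩
    ∑[ l < n ] (z * (A u l * idM (σ l) c) + y * A u l)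
      ≡⟨ ∑-distrib-+ (λ l → z * (A u l * idM (σ l) c)) (λ l → y * A u l) ⟩
    ∑[ l < n ] (z * (A u l * idM (σ l) c)) + ∑[ l < n ] (y * A u l)
      ≡⟨ cong₂ _+_ (sym (*-distribˡ-sum z (λ l → A u l * idM (σ l) c)))
          (sym (*-distribˡ-sum y (A u))) ⟩
    z * classSum A u c + y * ∑[ l < n ] A u l
      ≡⟨ cong₂ (λ s t → z * s + y * t) (classSum≡ eqA u c) (Equitable⇒rowSum eqA u) ⟩
    z * (a * idM (σ u) c + b) + y * (a + ℕ→ℚ k * b)
      ≡⟨ solve 6 (λ z a e b y K → z :* (a :* e :+ b) :+ y :* (a :+ K :* b)
          := a :* z :* e :+ (z :* b :+ y :* (a :+ K :* b)))
          refl z a (idM (σ u) c) b y (ℕ→ℚ k) ⟩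
    a * z * idM (σ u) c + (z * b + y * (a + ℕ→ℚ k * b)) ∎
    where open ≡-Reasoning

  equitable-qMat : ∀ {A a b} → Equitable A a b → ∀ d s → ∃[ y ] Equitable (qMat d s A) (qPoly d s a) y
  equitable-qMat eqA d = qGen-preserves (λ X z → ∃[ y ] Equitable X z y) d
    (0ℚ , equitable-idM)
    (λ (_ , eq) → _ , equitable-⊗ eqA eq)
    (λ (_ , eq) (_ , eq′) → _ , equitable-subM eq eq′)
    (λ a (_ , eq) → _ , equitable-scaleM a eq)

idM-diag : ∀ {n} (i : Fin n) → idM i i ≡ 1ℚ
idM-diag zero    = refl
idM-diag (suc i) = idM-diag i

1+ℕ→ℚ*negInv : ∀ m → 1ℚ + ℕ→ℚ (ℕ.suc m) * negInv (ℕ.suc m) ≡ 0ℚ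
1+ℕ→ℚ*negInv m = trans (cong (1ℚ +_) (ℕ→ℚ*negInv m)) (ℚ.+-inverseʳ 1ℚ)

module _ {n m : ℕ} (σ : Labelling n (ℕ.suc (ℕ.suc m))) where

  private
    ν : ℚ
    ν = negInv (ℕ.suc m)

  partitionMatrix≡ : ∀ u v → partitionMatrix σ u v ≡ (1ℚ - ν) * idM (σ v) (σ u) + ν
  partitionMatrix≡ u v rewrite idM-sym (σ v) (σ u) with σ u ==F σ v
  ... | true  = solve 1 (λ ν → con 1ℚ := (con 1ℚ :- ν) :* con 1ℚ :+ ν) refl ν
  ... | false = solve 1 (λ ν → ν := (con 1ℚ :- ν) :* con 0ℚ :+ ν) refl ν

  ∑-partitionMatrix-row : ∀ {X z y} → Equitable σ X z y → ∀ u → ∑[ v < n ] (partitionMatrix σ u v * X u v) ≡ z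
  ∑-partitionMatrix-row {X} {z} {y} eq u = begin
    ∑[ v < n ] (partitionMatrix σ u v * X u v)
      ≡⟨ sum-cong-≗ (λ v → trans (cong (_* X u v) (partitionMatrix≡ u v))
           (solve 3 (λ ν e x → ((con 1ℚ :- ν) :* e :+ ν) :* x := (con 1ℚ :- ν) :* (x :* e) :+ ν :* x)
                    refl ν (idM (σ v) (σ u)) (X u v))) ⟩
    ∑[ v < n ] ((1ℚ - ν) * (X u v * idM (σ v) (σ u)) + ν * X u v)
      ≡⟨ ∑-distrib-+ (λ v → (1ℚ - ν) * (X u v * idM (σ v) (σ u))) (λ v → ν * X u v) ⟩
    ∑[ v < n ] ((1ℚ - ν) * (X u v * idM (σ v) (σ u))) + ∑[ v < n ] (ν * X u v)
      ≡⟨ cong₂ _+_ (sym (*-distribˡ-sum (1ℚ - ν) (λ v → X u v * idM (σ v) (σ u)))) (sym (*-distribˡ-sum ν (X u))) ⟩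
    (1ℚ - ν) * classSum σ X u (σ u) + ν * ∑[ v < n ] X u v
      ≡⟨ cong₂ (λ s t → (1ℚ - ν) * s + ν * t) (Equitable.classSum≡ eq u (σ u)) (Equitable⇒rowSum σ eq u) ⟩
    (1ℚ - ν) * (z * idM (σ u) (σ u) + y) + ν * (z + ℕ→ℚ (ℕ.suc (ℕ.suc m)) * y)
      ≡⟨ cong₂ (λ e K → (1ℚ - ν) * (z * e + y) + ν * (z + K * y)) (idM-diag (σ u)) (ℕ→ℚ-suc (ℕ.suc m)) ⟩
    (1ℚ - ν) * (z * 1ℚ + y) + ν * (z + (1ℚ + ℕ→ℚ (ℕ.suc m)) * y)
      ≡⟨ solve 4 (λ ν z y M → (con 1ℚ :- ν) :* (z :* con 1ℚ :+ y) :+ ν :* (z :+ (con 1ℚ :+ M) :* y)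
                              := z :+ y :* (con 1ℚ :+ M :* ν)) refl ν z y (ℕ→ℚ (ℕ.suc m)) ⟩
    z + y * (1ℚ + ℕ→ℚ (ℕ.suc m) * ν)
      ≡⟨ cong (λ t → z + y * t) (1+ℕ→ℚ*negInv m) ⟩
    z + y * 0ℚ
      ≡⟨ solve 2 (λ z y → z :+ y :* con 0ℚ := z) refl z y ⟩
    z ∎
    where open ≡-Reasoning

  partitionMatrix-inner≡ : ∀ {X z y} → Equitable σ X z y → ⟨ partitionMatrix σ , X ⟩ ≡ ℕ→ℚ n * z
  partitionMatrix-inner≡ {X} {z} eq = begin
    sumFin n (λ u → sumFin n (λ v → P u v * X u v))  ≡⟨ sumFin≡sum n _ ⟩
    ∑[ u < n ] sumFin n (λ v → P u v * X u v)        ≡⟨ sum-cong-≗ (λ u → sumFin≡sum n (λ v → P u v * X u v)) ⟩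
    ∑[ u < n ] ∑[ v < n ] (P u v * X u v)           ≡⟨ sum-cong-≗ (∑-partitionMatrix-row eq) ⟩
    ∑[ u < n ] z                                     ≡⟨ ∑-const n z ⟩
    ℕ→ℚ n * z                                        ∎
    where
    open ≡-Reasoning
    P = partitionMatrix σ

allFinᵇ-sound : ∀ {n} (p : Fin n → Bool) → T (allFinᵇ n p) → ∀ i → T (p i)
allFinᵇ-sound p h zero    = proj₁ (Equivalence.to T-∧ h)
allFinᵇ-sound p h (suc i) = allFinᵇ-sound (p ∘ suc) (proj₂ (Equivalence.to T-∧ h)) i

==ℚ-sound : ∀ {p q} → T (p ==ℚ q) → p ≡ q
==ℚ-sound {p} {q} h with p ℚ.≟ q
... | yes p≡q = p≡q

dM≡ : ∀ d k η (i j : Fin k) → dM d k η i j ≡ ℕ→ℚ d * η * idM i j + ℕ→ℚ d * ((1ℚ - η) * inv k)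
dM≡ d k η i j with i ==F j
... | true  = solve 3 (λ d η b → d :* (η :+ b) := d :* η :* con 1ℚ :+ d :* b) refl (ℕ→ℚ d) η ((1ℚ - η) * inv k)
... | false = solve 3 (λ d η b → d :* (con 0ℚ :+ b) := d :* η :* con 0ℚ :+ d :* b) refl (ℕ→ℚ d) η ((1ℚ - η) * inv k)

module _ (d k : ℕ) (η : ℚ) {n : ℕ} (σ : Labelling n k) (G : Graph n)
         (compatible : T (isCompatible d k η σ G)) where

  isCompatible⇒countFin : ∀ u c → ℕ→ℚ (countFin n (λ v → (σ v ==F c) ∧ G u v)) ≡ dM d k η (σ u) c
  isCompatible⇒countFin u c =
    ==ℚ-sound (allFinᵇ-sound _ (allFinᵇ-sound _ (proj₂ (Equivalence.to T-∧ compatible)) u) c)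

  isCompatible⇒Equitable : Equitable σ (adj G) (ℕ→ℚ d * η) (ℕ→ℚ d * ((1ℚ - η) * inv k))
  isCompatible⇒Equitable = equitable λ u c → begin
    classSum σ (adj G) u c
      ≡⟨ sum-cong-≗ (λ v → indicator-* (G u v) (σ v ==F c)) ⟩
    ∑[ v < n ] (if (σ v ==F c) ∧ G u v then 1ℚ else 0ℚ)
      ≡⟨ ∑-indicator (λ v → (σ v ==F c) ∧ G u v) ⟩
    ℕ→ℚ (countFin n (λ v → (σ v ==F c) ∧ G u v))
      ≡⟨ isCompatible⇒countFin u c ⟩
    dM d k η (σ u) c
      ≡⟨ dM≡ d k η (σ u) c ⟩
    ℕ→ℚ d * η * idM (σ u) c + ℕ→ℚ d * ((1ℚ - η) * inv k) ∎
    where open ≡-Reasoning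

deviation≡0 : ∀ d m η s n (σ : Labelling n (ℕ.suc (ℕ.suc m))) (G : Graph n) →
              T (isCompatible d (ℕ.suc (ℕ.suc m)) η σ G) → deviation d (ℕ.suc (ℕ.suc m)) η s n σ G ≡ 0ℚ
deviation≡0 d m η s n σ G compatible =
  trans (cong (_- x * ℕ→ℚ n) (partitionMatrix-inner≡ σ (proj₂ equitable-q)))
        (solve 2 (λ a b → a :* b :- b :* a := con 0ℚ) refl (ℕ→ℚ n) x)
  where
  x : ℚ
  x = qPoly d s (ℕ→ℚ d * η)

  equitable-q : ∃[ y ] Equitable σ (qMat d s (adj G)) x y
  equitable-q = equitable-qMat σ (isCompatible⇒Equitable d (ℕ.suc (ℕ.suc m)) η σ G compatible) d s

badCount≡0 : ∀ d k η s n t → 0ℚ ≤ t →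
             (∀ σ G → T (isCompatible d k η σ G) → deviation d k η s n σ G ≡ 0ℚ) →
             badCount d k η s n t ≡ 0
badCount≡0 d k η s n t 0≤t exact =
  cong length (filter-none (T? ∘ _) (All.map (λ {σG} → supported⇒small {σG}) supported))
  where
  supported : All.All (T ∘ _) (support d k η n)
  supported = all-filter (T? ∘ _) (cartesianProduct (allLabellings n k) (allGraphs n))

  supported⇒small : ∀ {σG : Labelling n k × Graph n} → let (σ , G) = σG in
                    T (isBalanced σ ∧ isCompatible d k η σ G) → ¬ T (not (∣ deviation d k η s n σ G ∣ ≤ᵇ t))
  supported⇒small {σ , G} inSupport large =
    subst T (Equivalence.to T-not-≡ large)
      (subst (λ r → T (∣ r ∣ ≤ᵇ t)) (sym (exact σ G compatible)) (ℚ.≤⇒≤ᵇ 0≤t))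
    where
    compatible : T (isCompatible d k η σ G)
    compatible = proj₂ (Equivalence.to (T-∧ {isBalanced σ}) inSupport)

lemma5p4 : (d k : ℕ) (η : ℚ) → 2 Data.Nat.≤ k
    → (∀ (i j : Fin k) → ∃ λ (m : ℕ) → dM d k η i j ≡ ℕ→ℚ m)
    → (s : ℕ) → 1 Data.Nat.≤ s
    → (Δ : ℕ → ℚ) → (∀ n → 0ℚ ≤ Δ n) → (∀ m n → m Data.Nat.≤ n → Δ m ≤ Δ n)
    → ∃ λ (C : ℚ) → ∃ λ (N : ℕ) → ∀ (n : ℕ) → N Data.Nat.≤ n → k ∣ n
    → (∀ (i : Fin k) → ∃ λ (t : ℕ) → dM d k η i i * ℕ→ℚ n ≡ ℕ→ℚ (2 Data.Nat.* t Data.Nat.* k))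
    → ℕ→ℚ (badCount d k η s n (Δ n)) * (Δ n * Δ n)
    ≤ C * ℕ→ℚ n * ℕ→ℚ (totalCount d k η n)
lemma5p4 d (ℕ.suc (ℕ.suc m)) η (s≤s (s≤s z≤n)) _ s _ Δ 0≤Δ _ = 0ℚ , 0 , λ n _ _ _ →
  let k = ℕ.suc (ℕ.suc m); total = ℕ→ℚ (totalCount d k η n) in ℚ.≤-reflexive (begin
    ℕ→ℚ (badCount d k η s n (Δ n)) * (Δ n * Δ n)
      ≡⟨ cong (λ b → ℕ→ℚ b * (Δ n * Δ n)) (badCount≡0 d k η s n (Δ n) (0≤Δ n) (deviation≡0 d m η s n)) ⟩
    0ℚ * (Δ n * Δ n)
      ≡⟨ ℚ.*-zeroˡ (Δ n * Δ n) ⟩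
    0ℚ
      ≡⟨ sym (trans (cong (_* total) (ℚ.*-zeroˡ (ℕ→ℚ n))) (ℚ.*-zeroˡ total)) ⟩
    0ℚ * ℕ→ℚ n * total ∎)
  where open ≡-Reasoning
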